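{- Let $n,d\ge1$ be integers. If $0\le i\le k\le nd$ are integers with $i\not\equiv0\pmod d$ and $k\not\equiv 0\pmod d$, then $H_i\le H_k$.
   Context: For $j\in\mathbb Z$ let $h_j=\#\{u\in\{1,\dots,d-1\}^n : u_1+\cdots+u_n=j\}$ (so $h_j=0$ unless $0\le j\le nd$). For an integer $m\le nd$, the arithmetic Hodge sum is $H_m=\sum_{t\ge0}h_{m-td}$ (so $H_m=0$ when $m<0$). -}

module Defs where

open import Data.Nat using (ℕ; zero; suc; _+_; _*_; _∸_; _≟_; _≤_)
open import Data.List using (List; []; _∷_; map; concatMap; length; filter; upTo)
open import Data.Nat.ListAction using (sum)
open import Data.Vec using (Vec; []; _∷_)
import Data.Vec as Vec
open import Relation.Binary.PropositionalEquality using (_≡_)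

digits : ℕ → List ℕ
digits d = map suc (upTo (d ∸ 1))

tuples : (n d : ℕ) → List (Vec ℕ n)
tuples zero    d = [] ∷ []
tuples (suc n) d = concatMap (λ a → map (a ∷_) (tuples n d)) (digits d)

h : (n d j : ℕ) → ℕ
h n d j = length (filter (λ u → Vec.sum u ≟ j) (tuples n d))

-- H_m = Σ_{t ≥ 0} h_{m - t d}, for m ≥ 0; the terms with m - t d < 0 vanish,
-- so only t = 0, …, m are needed (for d ≥ 1, t d ≤ m forces t ≤ m).
H : (n d m : ℕ) → ℕ
H n d m = sum (map (λ t → h n d (m ∸ t * d)) (filter (λ t → t * d Data.Nat.≤? m) (upTo (suc m))))

module Submission where

-- Write h_n, H_n for the sequences of the statement at level n, and
-- C_n(m) = Σ_{j ≤ m} h_n(j) for the prefix sums of h_n.  The proof rests on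
-- the complementarity identity
--     H_n(m) + H_{n+1}(m) = C_n(m),
-- the coefficientwise form of (1 + x + ⋯ + x^{d-1}) / (1 - x^d) = 1 / (1 - x):
-- peeling off the first coordinate shows that h_n(m) + h_{n+1}(m) is the
-- window sum Σ_{a < d} h_n(m - a), and H is the d-periodic sum of h.
-- Monotonicity is then proved by induction on n.  At level 0, H_0 vanishes off
-- the multiples of d.  If level n is monotone, a strong induction on k shows
-- that H_n grows no faster than C_n between admissible i ≤ k, i.e.
--     H_n(k) + C_n(i) ≤ H_n(i) + C_n(k),
-- and by complementarity this is exactly H_{n+1}(i) ≤ H_{n+1}(k).

open import Defs
open import Data.Nat using (ℕ; _*_; _≤_; _%_; NonZero)
open import Relation.Binary.PropositionalEquality using (_≢_)
open import Data.Nat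
  using (zero; suc; _+_; _∸_; _<_; _≤?_; _≟_; pred; z≤n; s≤s; >-nonZero⁻¹)
open import Data.Nat.Properties
open import Data.Nat.DivMod using (m≤n⇒[n∸m]%m≡n%m; m*n%n≡0)
open import Data.Nat.Induction using (<-rec)
open import Data.Nat.ListAction using (sum)
open import Data.List
  using (List; []; _∷_; _++_; map; filter; length; concatMap; applyUpTo; upTo)
open import Data.List.Properties using (length-++; filter-++; filter-≐; filter-none; map-∘)
open import Data.List.Relation.Unary.All using (universal)
import Data.Vec as Vec
open import Data.Product using (_,_)
open import Data.Sum using (inj₁; inj₂)
open import Data.Empty using (⊥-elim)
open import Function using (_∘_)
open import Algebra.Properties.CommutativeSemigroup +-commutativeSemigroup using (interchange)
open import Relation.Nullary using (Dec; yes; no; ¬_)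
open import Relation.Unary using (_≐_)
open import Relation.Binary.PropositionalEquality
  using (_≡_; refl; sym; trans; cong; cong₂; module ≡-Reasoning)

sumBelow : ℕ → (ℕ → ℕ) → ℕ
sumBelow zero    f = 0
sumBelow (suc N) f = f 0 + sumBelow N (f ∘ suc)

sumBelow-cong : ∀ {f g} N → (∀ i → f i ≡ g i) → sumBelow N f ≡ sumBelow N g
sumBelow-cong zero    f≡g = refl
sumBelow-cong (suc N) f≡g = cong₂ _+_ (f≡g 0) (sumBelow-cong N (f≡g ∘ suc))

sumBelow-snoc : ∀ f N → sumBelow (suc N) f ≡ sumBelow N f + f N
sumBelow-snoc f zero    = +-identityʳ (f 0)
sumBelow-snoc f (suc N) =
  trans (cong (f 0 +_) (sumBelow-snoc (f ∘ suc) N))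
        (sym (+-assoc (f 0) (sumBelow N (f ∘ suc)) (f (suc N))))

sumBelow-stable : ∀ f M N → M ≤ N → (∀ t → M ≤ t → f t ≡ 0) → sumBelow N f ≡ sumBelow M f
sumBelow-stable f zero    zero    _         _      = refl
sumBelow-stable f zero    (suc N) _         vanish = cong₂ _+_ (vanish 0 z≤n)
  (sumBelow-stable (f ∘ suc) 0 N z≤n (λ t _ → vanish (suc t) z≤n))
sumBelow-stable f (suc M) (suc N) (s≤s M≤N) vanish =
  cong (f 0 +_) (sumBelow-stable (f ∘ suc) M N M≤N (λ t M≤t → vanish (suc t) (s≤s M≤t)))

sumBelow-mono : ∀ f {M N} → M ≤ N → sumBelow M f ≤ sumBelow N f
sumBelow-mono f {zero}  {N}     _         = z≤n
sumBelow-mono f {suc M} {suc N} (s≤s M≤N) = +-monoʳ-≤ (f 0) (sumBelow-mono (f ∘ suc) M≤N)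

sum-map-applyUpTo : ∀ (g f : ℕ → ℕ) N → sum (map g (applyUpTo f N)) ≡ sumBelow N (g ∘ f)
sum-map-applyUpTo g f zero    = refl
sum-map-applyUpTo g f (suc N) = cong (g (f 0) +_) (sum-map-applyUpTo g (f ∘ suc) N)

when : {P : Set} → Dec P → ℕ → ℕ
when (yes _) x = x
when (no  _) _ = 0

when-yes : ∀ {P : Set} (P? : Dec P) {x} → P → when P? x ≡ x
when-yes (yes _) _ = refl
when-yes (no ¬p) p = ⊥-elim (¬p p)

when-no : ∀ {P : Set} (P? : Dec P) {x} → ¬ P → when P? x ≡ 0
when-no (yes p) ¬p = ⊥-elim (¬p p)
when-no (no  _) _  = refl

when-cong : ∀ {P Q : Set} (P? : Dec P) (Q? : Dec Q) {x y} →
  (P → Q) → (Q → P) → x ≡ y → when P? x ≡ when Q? y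
when-cong (yes _) (yes _) _   _   x≡y = x≡y
when-cong (yes p) (no ¬q) p→q _   _   = ⊥-elim (¬q (p→q p))
when-cong (no ¬p) (yes q) _   q→p _   = ⊥-elim (¬p (q→p q))
when-cong (no _)  (no _)  _   _   _   = refl

sum-map-filter : ∀ {P : ℕ → Set} (P? : ∀ x → Dec (P x)) (g : ℕ → ℕ) l →
  sum (map g (filter P? l)) ≡ sum (map (λ x → when (P? x) (g x)) l)
sum-map-filter P? g []      = refl
sum-map-filter P? g (x ∷ l) with P? x
... | yes _ = cong (g x +_) (sum-map-filter P? g l)
... | no  _ = sum-map-filter P? g l

module _ {A : Set} {P : A → Set} (P? : ∀ x → Dec (P x)) where

  count-concatMap : ∀ {B : Set} (F : B → List A) l →
    length (filter P? (concatMap F l)) ≡ sum (map (λ b → length (filter P? (F b))) l)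
  count-concatMap F []      = refl
  count-concatMap F (b ∷ l) = begin
    length (filter P? (F b ++ concatMap F l))
      ≡⟨ cong length (filter-++ P? (F b) (concatMap F l)) ⟩
    length (filter P? (F b) ++ filter P? (concatMap F l))
      ≡⟨ length-++ (filter P? (F b)) ⟩
    length (filter P? (F b)) + length (filter P? (concatMap F l))
      ≡⟨ cong (length (filter P? (F b)) +_) (count-concatMap F l) ⟩
    length (filter P? (F b)) + sum (map (λ b → length (filter P? (F b))) l) ∎
    where open ≡-Reasoning

  count-map : ∀ {B : Set} (f : B → A) l →
    length (filter P? (map f l)) ≡ length (filter (P? ∘ f) l)
  count-map f []      = refl
  count-map f (x ∷ l) with P? (f x)
  ... | yes _ = cong suc (count-map f l)
  ... | no  _ = count-map f l

count-prefixed : ∀ n d j a →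
  length (filter (λ u → Vec.sum u ≟ j) (map (a Vec.∷_) (tuples n d))) ≡ when (a ≤? j) (h n d (j ∸ a))
count-prefixed n d j a with a ≤? j
... | yes a≤j = trans (count-map (λ u → Vec.sum u ≟ j) (a Vec.∷_) (tuples n d))
                      (cong length (filter-≐ (λ u → a + Vec.sum u ≟ j) (λ u → Vec.sum u ≟ j ∸ a)
                                             shift-sum (tuples n d)))
  where
  shift-sum : (λ (u : Vec.Vec ℕ n) → a + Vec.sum u ≡ j) ≐ (λ u → Vec.sum u ≡ j ∸ a)
  shift-sum = (λ {u} e → trans (sym (m+n∸m≡n a (Vec.sum u))) (cong (_∸ a) e))
            , (λ e → trans (cong (a +_) e) (m+[n∸m]≡n a≤j))
... | no a≰j = trans (count-map (λ u → Vec.sum u ≟ j) (a Vec.∷_) (tuples n d))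
                     (cong length (filter-none (λ u → a + Vec.sum u ≟ j)
                                               (universal too-big (tuples n d))))
  where
  too-big : ∀ u → ¬ (a + Vec.sum u ≡ j)
  too-big u e = a≰j (≤-trans (m≤m+n a (Vec.sum u)) (≤-reflexive e))

h-suc : ∀ n d j →
  h (suc n) d j ≡ sumBelow (d ∸ 1) (λ a → when (suc a ≤? j) (h n d (j ∸ suc a)))
h-suc n d j = begin
  h (suc n) d j
    ≡⟨ count-concatMap (λ u → Vec.sum u ≟ j) (λ a → map (a Vec.∷_) (tuples n d)) (digits d) ⟩
  sum (map (λ a → length (filter (λ u → Vec.sum u ≟ j) (map (a Vec.∷_) (tuples n d)))) (digits d))
    ≡⟨ cong sum (map-cong-count (digits d)) ⟩
  sum (map (λ a → when (a ≤? j) (h n d (j ∸ a))) (map suc (upTo (d ∸ 1))))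
    ≡⟨ cong sum (sym (map-∘ (upTo (d ∸ 1)))) ⟩
  sum (map (λ a → when (suc a ≤? j) (h n d (j ∸ suc a))) (upTo (d ∸ 1)))
    ≡⟨ sum-map-applyUpTo _ (λ a → a) (d ∸ 1) ⟩
  sumBelow (d ∸ 1) (λ a → when (suc a ≤? j) (h n d (j ∸ suc a))) ∎
  where
  open ≡-Reasoning
  map-cong-count : ∀ l →
    map (λ a → length (filter (λ u → Vec.sum u ≟ j) (map (a Vec.∷_) (tuples n d)))) l
      ≡ map (λ a → when (a ≤? j) (h n d (j ∸ a))) l
  map-cong-count []      = refl
  map-cong-count (a ∷ l) = cong₂ _∷_ (count-prefixed n d j a) (map-cong-count l)

prefix : (ℕ → ℕ) → ℕ → ℕ
prefix f m = sumBelow (suc m) f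

prefix-gap : ∀ f {j k} → j < k → prefix f j + f k ≤ prefix f k
prefix-gap f {j} {k} j<k = begin
  prefix f j + f k    ≤⟨ +-monoˡ-≤ (f k) (sumBelow-mono f j<k) ⟩
  sumBelow k f + f k  ≡⟨ sym (sumBelow-snoc f k) ⟩
  prefix f k          ∎
  where open ≤-Reasoning

rotate : ∀ x y z → x + (y + z) ≡ y + (z + x)
rotate x y z = trans (+-comm x (y + z)) (+-assoc y z x)

prefix-absorb : ∀ f {i k a b} → i < k → a ≤ f k + b → a + prefix f i ≤ b + prefix f k
prefix-absorb f {i} {k} {a} {b} i<k a≤fk+b = begin
  a + prefix f i          ≤⟨ +-monoˡ-≤ (prefix f i) a≤fk+b ⟩
  (f k + b) + prefix f i  ≡⟨ trans (+-assoc (f k) b (prefix f i)) (rotate (f k) b (prefix f i)) ⟩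
  b + (prefix f i + f k)  ≤⟨ +-monoʳ-≤ b (prefix-gap f i<k) ⟩
  b + prefix f k          ∎
  where open ≤-Reasoning

window : (ℕ → ℕ) → ℕ → ℕ → ℕ
window f N m = sumBelow N (λ a → when (a ≤? m) (f (m ∸ a)))

window+prefix : ∀ f N m → N ≤ m → window f N m + prefix f (m ∸ N) ≡ prefix f m
window+prefix f zero    m _   = refl
window+prefix f (suc N) m N<m = begin
  window f (suc N) m + prefix f (m ∸ suc N)
    ≡⟨ cong (_+ prefix f (m ∸ suc N)) (sumBelow-snoc _ N) ⟩
  (window f N m + when (N ≤? m) (f (m ∸ N))) + prefix f (m ∸ suc N)
    ≡⟨ cong (λ x → (window f N m + x) + prefix f (m ∸ suc N)) (when-yes (N ≤? m) (<⇒≤ N<m)) ⟩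
  (window f N m + f (m ∸ N)) + prefix f (m ∸ suc N)
    ≡⟨ trans (+-assoc (window f N m) (f (m ∸ N)) (prefix f (m ∸ suc N)))
             (cong (window f N m +_) (+-comm (f (m ∸ N)) (prefix f (m ∸ suc N)))) ⟩
  window f N m + (prefix f (m ∸ suc N) + f (m ∸ N))
    ≡⟨ cong (window f N m +_) last-term ⟩
  window f N m + prefix f (m ∸ N)
    ≡⟨ window+prefix f N m (<⇒≤ N<m) ⟩
  prefix f m ∎
  where
  open ≡-Reasoning
  m∸N≡suc : ∀ {m} → suc N ≤ m → m ∸ N ≡ suc (m ∸ suc N)
  m∸N≡suc {suc m} (s≤s N≤m) = +-∸-assoc 1 N≤m
  last-term : prefix f (m ∸ suc N) + f (m ∸ N) ≡ prefix f (m ∸ N)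
  last-term rewrite m∸N≡suc N<m = sym (sumBelow-snoc f (suc (m ∸ suc N)))

window-all : ∀ f N m → m < N → window f N m ≡ prefix f m
window-all f N m m<N = begin
  window f N m                                   ≡⟨ sumBelow-stable _ (suc m) N m<N beyond ⟩
  window f (suc m) m                             ≡⟨ sumBelow-snoc _ m ⟩
  window f m m + when (m ≤? m) (f (m ∸ m))       ≡⟨ cong (window f m m +_) first-value ⟩
  window f m m + prefix f (m ∸ m)                ≡⟨ window+prefix f m m ≤-refl ⟩
  prefix f m                                     ∎
  where
  open ≡-Reasoning
  beyond : ∀ t → suc m ≤ t → when (t ≤? m) (f (m ∸ t)) ≡ 0
  beyond t m<t = when-no (t ≤? m) (<⇒≱ m<t)
  first-value : when (m ≤? m) (f (m ∸ m)) ≡ prefix f (m ∸ m)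
  first-value rewrite n∸n≡0 m = trans (when-yes (m ≤? m) ≤-refl) (sym (+-identityʳ (f 0)))

module Periodic (d : ℕ) .{{_ : NonZero d}} where

  -- Σ_{t ≥ 0, td ≤ m} f(m - td); by definition H_n is the periodic sum of h_n.
  periodicSum : (ℕ → ℕ) → ℕ → ℕ
  periodicSum f m = sum (map (λ t → f (m ∸ t * d)) (filter (λ t → t * d ≤? m) (upTo (suc m))))

  periodicTerm : (ℕ → ℕ) → ℕ → ℕ → ℕ
  periodicTerm f m t = when (t * d ≤? m) (f (m ∸ t * d))

  periodicSum-as-sumBelow : ∀ f m → periodicSum f m ≡ sumBelow (suc m) (periodicTerm f m)
  periodicSum-as-sumBelow f m =
    trans (sum-map-filter (λ t → t * d ≤? m) (λ t → f (m ∸ t * d)) (upTo (suc m)))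
          (sum-map-applyUpTo (periodicTerm f m) (λ t → t) (suc m))

  m∸d<m : ∀ {m} → d ≤ m → m ∸ d < m
  m∸d<m d≤m = ∸-monoʳ-< (>-nonZero⁻¹ d) d≤m

  residue-∸ : ∀ {m} → d ≤ m → m % d ≢ 0 → (m ∸ d) % d ≢ 0
  residue-∸ d≤m m≢0 r = m≢0 (trans (sym (m≤n⇒[n∸m]%m≡n%m d≤m)) r)

  periodicSum-below : ∀ f m → ¬ d ≤ m → periodicSum f m ≡ f m
  periodicSum-below f m d≰m = begin
    periodicSum f m
      ≡⟨ periodicSum-as-sumBelow f m ⟩
    periodicTerm f m 0 + sumBelow m (periodicTerm f m ∘ suc)
      ≡⟨ cong₂ _+_ (when-yes (0 * d ≤? m) z≤n)
                   (sumBelow-stable _ 0 m z≤n (λ t _ → when-no (suc t * d ≤? m) (too-big t))) ⟩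
    f m + 0
      ≡⟨ +-identityʳ (f m) ⟩
    f m ∎
    where
    open ≡-Reasoning
    too-big : ∀ t → ¬ (suc t * d ≤ m)
    too-big t le = d≰m (≤-trans (m≤m+n d (t * d)) le)

  periodicSum-step : ∀ f m → d ≤ m → periodicSum f m ≡ f m + periodicSum f (m ∸ d)
  periodicSum-step f m d≤m = begin
    periodicSum f m
      ≡⟨ periodicSum-as-sumBelow f m ⟩
    periodicTerm f m 0 + sumBelow m (periodicTerm f m ∘ suc)
      ≡⟨ cong₂ _+_ (when-yes (0 * d ≤? m) z≤n) (sumBelow-cong m shift) ⟩
    f m + sumBelow m (periodicTerm f (m ∸ d))
      ≡⟨ cong (f m +_) (sumBelow-stable _ (suc (m ∸ d)) m (m∸d<m d≤m) beyond) ⟩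
    f m + sumBelow (suc (m ∸ d)) (periodicTerm f (m ∸ d))
      ≡⟨ cong (f m +_) (sym (periodicSum-as-sumBelow f (m ∸ d))) ⟩
    f m + periodicSum f (m ∸ d) ∎
    where
    open ≡-Reasoning
    shift : ∀ t → periodicTerm f m (suc t) ≡ periodicTerm f (m ∸ d) t
    shift t = when-cong (suc t * d ≤? m) (t * d ≤? m ∸ d)
      (λ le → m+n≤o⇒m≤o∸n (t * d) (≤-trans (≤-reflexive (+-comm (t * d) d)) le))
      (λ le → ≤-trans (≤-reflexive (+-comm d (t * d))) (m≤o∸n⇒m+n≤o (t * d) d≤m le))
      (cong f (sym (∸-+-assoc m d (t * d))))
    beyond : ∀ t → suc (m ∸ d) ≤ t → periodicTerm f (m ∸ d) t ≡ 0
    beyond t m∸d<t = when-no (t * d ≤? m ∸ d) (λ le → <⇒≱ m∸d<t (≤-trans (m≤m*n t d) le))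

  h-window : ∀ n m → h n d m + h (suc n) d m ≡ window (h n d) d m
  h-window n m = begin
    h n d m + h (suc n) d m
      ≡⟨ cong₂ _+_ (sym (when-yes (0 ≤? m) z≤n)) (h-suc n d m) ⟩
    window (h n d) (suc (pred d)) m
      ≡⟨ cong (λ N → window (h n d) N m) (suc-pred d) ⟩
    window (h n d) d m ∎
    where open ≡-Reasoning

  complement : ∀ n m → H n d m + H (suc n) d m ≡ prefix (h n d) m
  complement n = <-rec (λ m → H n d m + H (suc n) d m ≡ prefix (h n d) m) step
    where
    open ≡-Reasoning
    step : ∀ m → (∀ {m'} → m' < m → H n d m' + H (suc n) d m' ≡ prefix (h n d) m') →
      H n d m + H (suc n) d m ≡ prefix (h n d) m
    step m rec with d ≤? m
    ... | yes d≤m = begin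
      H n d m + H (suc n) d m
        ≡⟨ cong₂ _+_ (periodicSum-step (h n d) m d≤m) (periodicSum-step (h (suc n) d) m d≤m) ⟩
      (h n d m + H n d (m ∸ d)) + (h (suc n) d m + H (suc n) d (m ∸ d))
        ≡⟨ interchange (h n d m) (H n d (m ∸ d)) (h (suc n) d m) (H (suc n) d (m ∸ d)) ⟩
      (h n d m + h (suc n) d m) + (H n d (m ∸ d) + H (suc n) d (m ∸ d))
        ≡⟨ cong₂ _+_ (h-window n m) (rec (m∸d<m d≤m)) ⟩
      window (h n d) d m + prefix (h n d) (m ∸ d)
        ≡⟨ window+prefix (h n d) d m d≤m ⟩
      prefix (h n d) m ∎
    ... | no d≰m = begin
      H n d m + H (suc n) d m
        ≡⟨ cong₂ _+_ (periodicSum-below (h n d) m d≰m) (periodicSum-below (h (suc n) d) m d≰m) ⟩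
      h n d m + h (suc n) d m
        ≡⟨ h-window n m ⟩
      window (h n d) d m
        ≡⟨ window-all (h n d) d m (≰⇒> d≰m) ⟩
      prefix (h n d) m ∎

  -- At level 0 only the empty tuple exists, so H_0 vanishes off the multiples of d.
  H₀-vanishes : ∀ m → m % d ≢ 0 → H 0 d m ≡ 0
  H₀-vanishes = <-rec (λ m → m % d ≢ 0 → H 0 d m ≡ 0) step
    where
    h₀-vanishes : ∀ m → m % d ≢ 0 → h 0 d m ≡ 0
    h₀-vanishes zero    0≢0 = ⊥-elim (0≢0 (m*n%n≡0 0 d))
    h₀-vanishes (suc m) _   = refl
    step : ∀ m → (∀ {m'} → m' < m → m' % d ≢ 0 → H 0 d m' ≡ 0) → m % d ≢ 0 → H 0 d m ≡ 0
    step m rec m≢0 with d ≤? m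
    ... | yes d≤m = trans (periodicSum-step (h 0 d) m d≤m)
                          (cong₂ _+_ (h₀-vanishes m m≢0) (rec (m∸d<m d≤m) (residue-∸ d≤m m≢0)))
    ... | no d≰m  = trans (periodicSum-below (h 0 d) m d≰m) (h₀-vanishes m m≢0)

  Monotone : ℕ → Set
  Monotone n = ∀ {i k} → i ≤ k → i % d ≢ 0 → k % d ≢ 0 → H n d i ≤ H n d k

  monotone-zero : Monotone 0
  monotone-zero {i} _ i≢0 _ = ≤-trans (≤-reflexive (H₀-vanishes i i≢0)) z≤n

  increment-bound : ∀ {n} → Monotone n → ∀ k {i} → i ≤ k → i % d ≢ 0 → k % d ≢ 0 →
    H n d k + prefix (h n d) i ≤ H n d i + prefix (h n d) k
  increment-bound {n} mono = <-rec Bound step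
    where
    C : ℕ → ℕ
    C = prefix (h n d)
    Bound : ℕ → Set
    Bound k = ∀ {i} → i ≤ k → i % d ≢ 0 → k % d ≢ 0 → H n d k + C i ≤ H n d i + C k
    step : ∀ k → (∀ {k'} → k' < k → Bound k') → Bound k
    step k rec {i} i≤k i≢0 k≢0 with m≤n⇒m<n∨m≡n i≤k
    ... | inj₂ refl = ≤-refl
    ... | inj₁ i<k with d ≤? k
    ...   | no d≰k = prefix-absorb (h n d) i<k
                       (≤-trans (≤-reflexive (periodicSum-below (h n d) k d≰k))
                                (m≤m+n (h n d k) (H n d i)))
    ...   | yes d≤k with i ≤? k ∸ d
    ...     | no k∸d≱i = prefix-absorb (h n d) i<k (begin
              H n d k                     ≡⟨ periodicSum-step (h n d) k d≤k ⟩
              h n d k + H n d (k ∸ d)     ≤⟨ +-monoʳ-≤ (h n d k) (mono (<⇒≤ (≰⇒> k∸d≱i))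
                                               (residue-∸ d≤k k≢0) i≢0) ⟩
              h n d k + H n d i           ∎)
      where open ≤-Reasoning
    ...     | yes i≤k∸d = begin
              H n d k + C i                   ≡⟨ cong (_+ C i) (periodicSum-step (h n d) k d≤k) ⟩
              (h n d k + H n d (k ∸ d)) + C i ≡⟨ +-assoc (h n d k) (H n d (k ∸ d)) (C i) ⟩
              h n d k + (H n d (k ∸ d) + C i) ≤⟨ +-monoʳ-≤ (h n d k) (rec (m∸d<m d≤k) i≤k∸d i≢0
                                                   (residue-∸ d≤k k≢0)) ⟩
              h n d k + (H n d i + C (k ∸ d)) ≡⟨ rotate (h n d k) (H n d i) (C (k ∸ d)) ⟩
              H n d i + (C (k ∸ d) + h n d k) ≤⟨ +-monoʳ-≤ (H n d i) (prefix-gap (h n d) (m∸d<m d≤k)) ⟩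
              H n d i + C k                   ∎
      where open ≤-Reasoning

  -- By complementarity, the increment bound at level n is monotonicity at level n + 1.
  monotone-suc : ∀ {n} → Monotone n → Monotone (suc n)
  monotone-suc {n} mono {i} {k} i≤k i≢0 k≢0 = +-cancelˡ-≤ (H n d k + H n d i) _ _ (begin
    (H n d k + H n d i) + H (suc n) d i   ≡⟨ +-assoc (H n d k) (H n d i) (H (suc n) d i) ⟩
    H n d k + (H n d i + H (suc n) d i)   ≡⟨ cong (H n d k +_) (complement n i) ⟩
    H n d k + prefix (h n d) i            ≤⟨ increment-bound {n} mono k i≤k i≢0 k≢0 ⟩
    H n d i + prefix (h n d) k            ≡⟨ cong (H n d i +_) (sym (complement n k)) ⟩
    H n d i + (H n d k + H (suc n) d k)   ≡⟨ sym (+-assoc (H n d i) (H n d k) (H (suc n) d k)) ⟩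
    (H n d i + H n d k) + H (suc n) d k   ≡⟨ cong (_+ H (suc n) d k) (+-comm (H n d i) (H n d k)) ⟩
    (H n d k + H n d i) + H (suc n) d k   ∎)
    where open ≤-Reasoning

  monotone : ∀ n → Monotone n
  monotone zero    = monotone-zero
  monotone (suc n) = monotone-suc {n} (monotone n)

mainTheorem6 : (n d : ℕ) → .{{_ : NonZero n}} → .{{_ : NonZero d}} →
    (i k : ℕ) → i ≤ k → k ≤ n * d → i % d ≢ 0 → k % d ≢ 0 →
    H n d i ≤ H n d k
mainTheorem6 n d i k i≤k _ i≢0 k≢0 = Periodic.monotone d n i≤k i≢0 k≢0
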